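{- Let $a,x,y$ be indeterminates and let $D=ax\frac{\partial}{\partial a}+xy\frac{\partial}{\partial x}+x^2\frac{\partial}{\partial y}$ be the derivation on polynomials in $a,x,y$ with $D(a)=ax$, $D(x)=xy$, $D(y)=x^2$; for a polynomial $f$ put $\mathrm{Gen}(f,t)=\sum_{n\ge0}D^n(f)\frac{t^n}{n!}$. Then $$(x+y)\,\mathrm{Gen}(a,t)=a\big(\mathrm{Gen}(x,t)+\mathrm{Gen}(y,t)\big),$$ or equivalently, for all $n\ge0$, $$(x+y)\Lambda_n(x,y)=L_n(x,y)+W_n(x,y).$$
   Context: For a permutation $\sigma$ of $[n]$, prepend $\sigma_0=0$; an up-down run is a maximal increasing or decreasing segment of consecutive entries of $\sigma_0\sigma_1\cdots\sigma_n$. $\Lambda(n,k)$ is the number of permutations of $[n]$ with $k$ up-down runs, $\Lambda_n(x,y)=\sum_{k=1}^n\Lambda(n,k)x^ky^{n-k}$ for $n\ge1$ and $\Lambda_0(x,y)=1$. A left peak is an index $1\le i\le n-1$ with $\sigma_{i-1}<\sigma_i>\sigma_{i+1}$ ($\sigma_0=0$); an exterior peak is an index $1\le i\le n$ with $\sigma_{i-1}<\sigma_i>\sigma_{i+1}$ ($\sigma_0=\sigma_{n+1}=0$); $L(n,k)$, $W(n,k)$ count permutations of $[n]$ with $k$ left, resp. exterior, peaks. For $n\ge1$, $L_n(x,y)=\sum_{k=0}^{\lfloor n/2\rfloor}L(n,k)x^{2k+1}y^{n-2k}$, $W_n(x,y)=\sum_{k=1}^{\lfloor(n+1)/2\rfloor}W(n,k)x^{2k}y^{n-2k+1}$,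 and $L_0(x,y)=x$, $W_0(x,y)=y$. -}

module Defs where

open import Level using (Level)
open import Data.Nat as ℕ using (ℕ; zero; suc; _∸_; _<ᵇ_)
open import Data.Nat.Properties using (_≟_)
open import Data.Bool using (Bool; true; false; _∧_; _xor_; if_then_else_)
open import Data.List using (List; []; _∷_; _++_; map; concatMap; filter; length; upTo; foldr)
open import Data.List.Relation.Unary.Unique.DecPropositional _≟_ using (unique?)
open import Algebra.Bundles using (CommutativeSemiring)

words : ℕ → ℕ → List (List ℕ)
words n zero    = [] ∷ []
words n (suc k) = concatMap (λ w → map (λ i → suc i ∷ w) (upTo n)) (words n k)

-- The permutations of [n] = {1,…,n}, in one-line notation σ₁σ₂⋯σₙ:
-- the length-n words over [n] with pairwise distinct entries.
perms : ℕ → List (List ℕ)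
perms n = filter unique? (words n n)

peaks : List ℕ → ℕ
peaks (a ∷ b ∷ c ∷ l) =
  (if (a <ᵇ b) ∧ (c <ᵇ b) then 1 else 0) ℕ.+ peaks (b ∷ c ∷ l)
peaks _ = 0

turns : List ℕ → ℕ
turns (a ∷ b ∷ c ∷ l) =
  (if (a <ᵇ b) xor (b <ᵇ c) then 1 else 0) ℕ.+ turns (b ∷ c ∷ l)
turns _ = 0

-- Number of up-down runs of σ (σ nonempty): the number of maximal monotone
-- segments of 0σ₁⋯σₙ, i.e. 1 + number of direction changes.
udruns : List ℕ → ℕ
udruns σ = suc (turns (0 ∷ σ))

-- left peaks: 1 ≤ i ≤ n-1 with σ_{i-1} < σ_i > σ_{i+1}, σ₀ = 0
lpk : List ℕ → ℕ
lpk σ = peaks (0 ∷ σ)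

-- exterior peaks: 1 ≤ i ≤ n with σ_{i-1} < σ_i > σ_{i+1}, σ₀ = σ_{n+1} = 0
epk : List ℕ → ℕ
epk σ = peaks (0 ∷ σ ++ 0 ∷ [])

module Polys {c ℓ : Level} (R : CommutativeSemiring c ℓ) where
  open CommutativeSemiring R

  pow : Carrier → ℕ → Carrier
  pow z zero    = 1#
  pow z (suc k) = z * pow z k

  sumOver : List (List ℕ) → (List ℕ → Carrier) → Carrier
  sumOver ps f = foldr (λ σ acc → f σ + acc) 0# ps

  Λ : ℕ → Carrier → Carrier → Carrier
  Λ zero    x y = 1#
  Λ (suc n) x y = sumOver (perms (suc n))
    (λ σ → pow x (udruns σ) * pow y (suc n ∸ udruns σ))

  Lp : ℕ → Carrier → Carrier → Carrier
  Lp zero    x y = x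
  Lp (suc n) x y = sumOver (perms (suc n))
    (λ σ → pow x (suc (2 ℕ.* lpk σ)) * pow y (suc n ∸ 2 ℕ.* lpk σ))

  Wp : ℕ → Carrier → Carrier → Carrier
  Wp zero    x y = y
  Wp (suc n) x y = sumOver (perms (suc n))
    (λ σ → pow x (2 ℕ.* epk σ) * pow y (suc (suc n) ∸ 2 ℕ.* epk σ))

{-# OPTIONS --safe #-}

-- The identity holds summand by summand.  Scan 0σ₁⋯σₙ0 from the left: every
-- direction change is alternately a peak and a valley, the first one after the
-- initial ascent being a peak.  Hence with r = udruns σ, either σ ends
-- ascending, and then 2·lpk σ + 1 = r and 2·epk σ = r + 1 (the final 0 adds one
-- exterior peak), or σ ends descending, and then 2·lpk σ = 2·epk σ = r.  In both
-- cases {2·lpk σ + 1, 2·epk σ} = {r, r + 1}, so multiplying the Λ-monomial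
-- x^r yⁿ⁻ʳ by x + y gives exactly the L-monomial plus the W-monomial of σ.
module Submission where

open import Defs
open import Level using (Level)
open import Algebra.Bundles using (CommutativeSemiring)
import Algebra.Properties.CommutativeSemigroup as CommutativeSemigroupProperties
open import Data.Bool using (Bool; true; false; not; _∧_; _xor_; if_then_else_)
open import Data.List using (List; []; _∷_; _++_; map; length; upTo)
open import Data.List.Relation.Unary.All as All using (All; []; _∷_)
open import Data.List.Relation.Unary.All.Properties using (map⁺; concat⁺; filter⁺; all-filter)
open import Data.List.Relation.Unary.Linked using (Linked; []; [-]; _∷_)
open import Data.List.Relation.Unary.Linked.Properties using (AllPairs⇒Linked)
open import Data.Nat as Nat using (ℕ; zero; suc; _<ᵇ_; _≤_; _<_; z≤n; s≤s; z<s)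
open import Data.Nat.Properties using (_≟_; +-suc; +-∸-assoc; m≤n⇒m≤1+n; <⇒≢; >⇒≢)
open import Data.List.Relation.Unary.Unique.DecPropositional _≟_ using (unique?; Unique)
open import Data.Product using (_×_; _,_)
open import Data.Sum using (_⊎_; inj₁; inj₂)
open import Relation.Nullary using (contradiction)
open import Relation.Binary.PropositionalEquality as ≡ using (_≡_; _≢_)
import Relation.Binary.Reasoning.Setoid as SetoidReasoning

module UpDownRuns where
  open import Data.Nat using (_+_; _*_)
  open ≡ using (refl; cong; subst)

  2*-suc : ∀ p → 2 * suc p ≡ suc (suc (2 * p))
  2*-suc p = cong suc (+-suc p (p + 0))

  <ᵇ-flip : ∀ {m n} → m ≢ n → (n <ᵇ m) ≡ not (m <ᵇ n)
  <ᵇ-flip {zero}  {zero}  m≢n = contradiction refl m≢n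
  <ᵇ-flip {zero}  {suc n} m≢n = refl
  <ᵇ-flip {suc m} {zero}  m≢n = refl
  <ᵇ-flip {suc m} {suc n} m≢n = <ᵇ-flip (λ m≡n → m≢n (cong suc m≡n))

  -- The possible values of (turns w, peaks w, peaks (w ++ 0 ∷ [])) for a word w
  -- with distinct neighbours, by the directions of its first and last step.
  data Balanced : (firstUp : Bool) (t p e : ℕ) → Set where
    up-up     : ∀ p → Balanced true  (2 * p)       p       (suc p)
    up-down   : ∀ p → Balanced true  (suc (2 * p)) (suc p) (suc p)
    down-down : ∀ p → Balanced false (2 * p)       p       p
    down-up   : ∀ p → Balanced false (suc (2 * p)) p       (suc p)

  Balanced-cons : ∀ u {v t p e} → Balanced v t p e →
    Balanced u ((if u xor v then 1 else 0) + t)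
               ((if u ∧ not v then 1 else 0) + p)
               ((if u ∧ not v then 1 else 0) + e)
  Balanced-cons true  (up-up p)     = up-up p
  Balanced-cons true  (up-down p)   = up-down p
  Balanced-cons true  (down-down p) = up-down p
  Balanced-cons true  (down-up p)   =
    subst (λ t → Balanced true t (suc p) (suc (suc p))) (2*-suc p) (up-up (suc p))
  Balanced-cons false (up-up p)     = down-up p
  Balanced-cons false (up-down p)   =
    subst (λ t → Balanced false t (suc p) (suc p)) (2*-suc p) (down-down (suc p))
  Balanced-cons false (down-down p) = down-down p
  Balanced-cons false (down-up p)   = down-up p

  balanced : ∀ a b l → Linked _≢_ (a ∷ b ∷ l ++ 0 ∷ []) →
    Balanced (a <ᵇ b) (turns (a ∷ b ∷ l)) (peaks (a ∷ b ∷ l)) (peaks (a ∷ b ∷ l ++ 0 ∷ []))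
  balanced a zero    []      (_ ∷ b≢0 ∷ [-]) = contradiction refl b≢0
  balanced a (suc b) []      _ with a <ᵇ suc b
  ... | true  = up-up 0
  ... | false = down-down 0
  balanced a b       (c ∷ l) (_ ∷ bcl@(b≢c ∷ _)) rewrite <ᵇ-flip b≢c =
    Balanced-cons (a <ᵇ b) (balanced b c l bcl)

  Balanced-up : ∀ {t p e} → Balanced true t p e →
    (suc (2 * p) ≡ suc t × 2 * e ≡ suc (suc t)) ⊎ (suc (2 * p) ≡ suc (suc t) × 2 * e ≡ suc t)
  Balanced-up (up-up p)   = inj₁ (refl , 2*-suc p)
  Balanced-up (up-down p) = inj₂ (cong suc (2*-suc p) , 2*-suc p)

  udruns-peaks : ∀ σ → Linked _≢_ (0 ∷ σ ++ 0 ∷ []) →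
    (suc (2 * lpk σ) ≡ udruns σ × 2 * epk σ ≡ suc (udruns σ)) ⊎
    (suc (2 * lpk σ) ≡ suc (udruns σ) × 2 * epk σ ≡ udruns σ)
  udruns-peaks []          (0≢0 ∷ _) = contradiction refl 0≢0
  udruns-peaks (zero  ∷ l) (0≢0 ∷ _) = contradiction refl 0≢0
  udruns-peaks (suc b ∷ l) h         = Balanced-up (balanced 0 (suc b) l h)

  turns-≤ : ∀ a b l → turns (a ∷ b ∷ l) ≤ length l
  turns-≤ a b []      = z≤n
  turns-≤ a b (c ∷ l) with (a <ᵇ b) xor (b <ᵇ c)
  ... | true  = s≤s (turns-≤ b c l)
  ... | false = m≤n⇒m≤1+n (turns-≤ b c l)

  udruns-≤-length : ∀ b l → udruns (b ∷ l) ≤ length (b ∷ l)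
  udruns-≤-length b l = s≤s (turns-≤ 0 b l)

  ++-zero⁺ : ∀ {σ} → All (0 <_) σ → Linked _≢_ σ → Linked _≢_ (σ ++ 0 ∷ [])
  ++-zero⁺ []         []          = [-]
  ++-zero⁺ (0<b ∷ []) [-]         = >⇒≢ 0<b ∷ [-]
  ++-zero⁺ (_ ∷ 0<σ)  (b≢c ∷ bcl) = b≢c ∷ ++-zero⁺ 0<σ bcl

  words-positive : ∀ n k → All (λ w → length w ≡ k × All (0 <_) w) (words n k)
  words-positive n zero    = (refl , []) ∷ []
  words-positive n (suc k) = concat⁺ (map⁺ (All.map extend (words-positive n k)))
    where
    extend : ∀ {w} → length w ≡ k × All (0 <_) w →
             All (λ w → length w ≡ suc k × All (0 <_) w) (map (λ i → suc i ∷ w) (upTo n))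
    extend (|w| , 0<w) = map⁺ (All.universal (λ _ → cong suc |w| , z<s ∷ 0<w) (upTo n))

  perms-zero-bordered : ∀ n →
    All (λ σ → length σ ≡ suc n × Linked _≢_ (0 ∷ σ ++ 0 ∷ [])) (perms (suc n))
  perms-zero-bordered n = All.map bordered
    (All.zip (filter⁺ unique? (words-positive (suc n) (suc n)) , all-filter unique? (words (suc n) (suc n))))
    where
    bordered : ∀ {σ} → (length σ ≡ suc n × All (0 <_) σ) × Unique σ →
               length σ ≡ suc n × Linked _≢_ (0 ∷ σ ++ 0 ∷ [])
    bordered {b ∷ l} ((|σ| , 0<σ@(0<b ∷ _)) , σ-unique) =
      |σ| , <⇒≢ 0<b ∷ ++-zero⁺ 0<σ (AllPairs⇒Linked σ-unique)

open UpDownRuns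

module Sums {c ℓ : Level} (R : CommutativeSemiring c ℓ) where
  open CommutativeSemiring R
  open Polys R
  open SetoidReasoning setoid
  open CommutativeSemigroupProperties +-commutativeSemigroup using (interchange)

  sumOver-*ˡ : ∀ z ps (f : List ℕ → Carrier) →
    z * sumOver ps f ≈ sumOver ps (λ σ → z * f σ)
  sumOver-*ˡ z []       f = zeroʳ z
  sumOver-*ˡ z (σ ∷ ps) f = trans (distribˡ z (f σ) _) (+-congˡ (sumOver-*ˡ z ps f))

  sumOver-+ : ∀ ps (f g : List ℕ → Carrier) →
    sumOver ps (λ σ → f σ + g σ) ≈ sumOver ps f + sumOver ps g
  sumOver-+ []       f g = sym (+-identityʳ 0#)
  sumOver-+ (σ ∷ ps) f g = begin
    (f σ + g σ) + sumOver ps (λ τ → f τ + g τ)   ≈⟨ +-congˡ (sumOver-+ ps f g) ⟩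
    (f σ + g σ) + (sumOver ps f + sumOver ps g)  ≈⟨ interchange _ _ _ _ ⟩
    (f σ + sumOver ps f) + (g σ + sumOver ps g)  ∎

  sumOver-cong : ∀ {ps} {f g : List ℕ → Carrier} →
    All (λ σ → f σ ≈ g σ) ps → sumOver ps f ≈ sumOver ps g
  sumOver-cong []          = refl
  sumOver-cong (fσ≈gσ ∷ h) = +-cong fσ≈gσ (sumOver-cong h)

module Monomials {c ℓ : Level} (R : CommutativeSemiring c ℓ) (x y : CommutativeSemiring.Carrier R) where
  open CommutativeSemiring R
  open Polys R
  open SetoidReasoning setoid
  open CommutativeSemigroupProperties *-commutativeSemigroup using (x∙yz≈y∙xz)

  mono : ℕ → ℕ → Carrier
  mono d k = pow x k * pow y (d Nat.∸ k)

  +-*-mono : ∀ {d k} → k ≤ d → (x + y) * mono d k ≈ mono (suc d) (suc k) + mono (suc d) k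
  +-*-mono {d} {k} k≤d = begin
    (x + y) * (pow x k * pow y (d Nat.∸ k))
      ≈⟨ distribʳ _ x y ⟩
    x * (pow x k * pow y (d Nat.∸ k)) + y * (pow x k * pow y (d Nat.∸ k))
      ≈⟨ +-cong (sym (*-assoc x _ _)) (x∙yz≈y∙xz y _ _) ⟩
    (x * pow x k) * pow y (d Nat.∸ k) + pow x k * (y * pow y (d Nat.∸ k))
      ≡⟨ ≡.cong (λ m → mono (suc d) (suc k) + pow x k * pow y m) (≡.sym (+-∸-assoc 1 k≤d)) ⟩
    mono (suc d) (suc k) + mono (suc d) k
      ∎

  udruns-summand : ∀ n {σ} → length σ ≡ suc n → Linked _≢_ (0 ∷ σ ++ 0 ∷ []) →
    (x + y) * mono (suc n) (udruns σ) ≈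
    mono (suc (suc n)) (suc (2 Nat.* lpk σ)) + mono (suc (suc n)) (2 Nat.* epk σ)
  udruns-summand n {b ∷ l} ≡.refl h with udruns-peaks (b ∷ l) h
  ... | inj₁ (lpk≡ , epk≡) = begin
    (x + y) * mono (suc n) r
      ≈⟨ +-*-mono (udruns-≤-length b l) ⟩
    mono (suc (suc n)) (suc r) + mono (suc (suc n)) r
      ≈⟨ +-comm _ _ ⟩
    mono (suc (suc n)) r + mono (suc (suc n)) (suc r)
      ≡⟨ ≡.cong₂ (λ i j → mono (suc (suc n)) i + mono (suc (suc n)) j) (≡.sym lpk≡) (≡.sym epk≡) ⟩
    mono (suc (suc n)) (suc (2 Nat.* lpk (b ∷ l))) + mono (suc (suc n)) (2 Nat.* epk (b ∷ l))
      ∎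
    where r = udruns (b ∷ l)
  ... | inj₂ (lpk≡ , epk≡) = begin
    (x + y) * mono (suc n) r
      ≈⟨ +-*-mono (udruns-≤-length b l) ⟩
    mono (suc (suc n)) (suc r) + mono (suc (suc n)) r
      ≡⟨ ≡.cong₂ (λ i j → mono (suc (suc n)) i + mono (suc (suc n)) j) (≡.sym lpk≡) (≡.sym epk≡) ⟩
    mono (suc (suc n)) (suc (2 Nat.* lpk (b ∷ l))) + mono (suc (suc n)) (2 Nat.* epk (b ∷ l))
      ∎
    where r = udruns (b ∷ l)

theorem3p3 : ∀ {c ℓ : Level} (R : CommutativeSemiring c ℓ) (n : ℕ) (x y : CommutativeSemiring.Carrier R) →
    CommutativeSemiring._≈_ R
      (CommutativeSemiring._*_ R (CommutativeSemiring._+_ R x y) (Polys.Λ R n x y))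
      (CommutativeSemiring._+_ R (Polys.Lp R n x y) (Polys.Wp R n x y))
theorem3p3 R zero    x y = CommutativeSemiring.*-identityʳ R _
theorem3p3 R (suc n) x y = begin
  (x + y) * Λ (suc n) x y
    ≈⟨ sumOver-*ˡ (x + y) (perms (suc n)) _ ⟩
  sumOver (perms (suc n)) (λ σ → (x + y) * mono (suc n) (udruns σ))
    ≈⟨ sumOver-cong (All.map (λ (|σ| , h) → udruns-summand n |σ| h) (perms-zero-bordered n)) ⟩
  sumOver (perms (suc n)) (λ σ → mono (suc (suc n)) (suc (2 Nat.* lpk σ)) + mono (suc (suc n)) (2 Nat.* epk σ))
    ≈⟨ sumOver-+ (perms (suc n)) _ _ ⟩
  Lp (suc n) x y + Wp (suc n) x y ∎
  where
  open CommutativeSemiring R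
  open Polys R
  open Sums R
  open Monomials R x y
  open SetoidReasoning setoid
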